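{- Let $(G,f,\pi)$ be a monotone SDS on the vertex set $\{1,\dots,n\}$ with update schedule $\pi$. Then every state $X\in [S_{0,k}]_{\pi}\cup [S_{1,k}]_{\pi}$, for some $k$ with $1\le k\le n$, is either a Garden-of-Eden state or reaches a fixed point of $F_\pi$.
   Context: Let $G$ be a simple graph with vertex set $\{1,\dots,n\}$. Each vertex has a state in $\mathbb{F}_2=\{0,1\}$; a state of the system is $X=[x_1,\dots,x_n]\in\mathbb{F}_2^n$. Each vertex $i$ has a local function $f_i$ whose arguments are the states of $i$ and its neighbours in $G$. The inflation $F_i:\mathbb{F}_2^n\to\mathbb{F}_2^n$ replaces the $i$-th coordinate of $X$ by the value of $f_i$ on the current states of $i$ and its neighbours and leaves all other coordinates unchanged. An update schedule is a permutation $\pi=\pi_1\pi_2\cdots\pi_n$ of the vertices, and $F_\pi=F_{\pi_n}\circ\cdots\circ F_{\pi_1}$; the triple $(G,f,\pi)$ (with $f=(f_i)_i$) is a sequential dynamical system (SDS). Order $\mathbb{F}_2^n$ componentwise with $0<1$. A function $g:\mathbb{F}_2^q\to\mathbb{F}_2$ is monotone if $X\le Y$ implies $g(X)\le g(Y)$; the SDS is monotone if every $f_i$ is monotone. A state $X$ is a Garden-of-Eden (GoE) state if there is no $Y$ with $F_\pi(Y)=X$; $X$ is a fixed point if $F_\pi(X)=X$; $X$ reaches a fixed point if $F_\pi^m(X)$ is a fixed point for some $m\ge0$. Two update schedules $\pi,\pi'$ satisfy $\pi\sim_\alpha\pi'$ if there is $k$ such that $\pi'$ is obtained from $\pi$ by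 exchanging the entries in positions $k$ and $k+1$ (all other entries equal) and the vertices $\pi_k,\pi_{k+1}$ are not adjacent in $G$; $[\pi]_\alpha$ denotes the equivalence class of $\pi$ under the reflexive–transitive closure of $\sim_\alpha$. A schedule $\sigma=\sigma_1\cdots\sigma_n$ is regarded as the permutation $i\mapsto\sigma_i$ of $\{1,\dots,n\}$, acting on states by $\sigma\cdot X=[x_{\sigma^{ -1}(1)},\dots,x_{\sigma^{ -1}(n)}]$. Set $[X]_\pi=\{\sigma\cdot X:\sigma\in[\pi]_\alpha\}$. $S_{0,k}\in\mathbb{F}_2^n$ is the state with $x_i=0$ for $i\le k$ and $x_i=1$ for $i>k$; $S_{1,k}$ is the state with $x_i=1$ for $i\le k$ and $x_i=0$ for $i>k$. -}

module Defs where

open import Data.Nat using (ℕ; zero; suc; _<_; _≤_)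
open import Data.Bool using (Bool; true; false) renaming (_≤_ to _≤ᵇ_)
open import Data.Fin using (Fin; toℕ)
open import Data.Fin.Permutation using (Permutation′; _⟨$⟩ʳ_; _⟨$⟩ˡ_; transpose)
open import Data.Vec using (Vec; lookup; tabulate; _[_]≔_)
open import Data.List using (List; foldl; map)
open import Data.List using () renaming (allFin to allFinL)
open import Data.Product using (Σ; ∃; _×_; _,_)
open import Data.Sum using (_⊎_)
open import Relation.Nullary using (¬_)
open import Relation.Binary.PropositionalEquality using (_≡_)
open import Relation.Nullary.Decidable using (⌊_⌋)
open import Data.Nat using (_<?_)
open import Data.Bool using (not)

-- A simple graph on vertex set Fin n (vertex i+1 of the paper = index i)
record Graph (n : ℕ) : Set where
  field
    adj     : Fin n → Fin n → Bool
    symm    : ∀ i j → adj i j ≡ adj j i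
    irrefl  : ∀ i → adj i i ≡ false
open Graph public

State : ℕ → Set
State n = Vec Bool n

_≤ₛ_ : ∀ {n} → State n → State n → Set
X ≤ₛ Y = ∀ i → lookup X i ≤ᵇ lookup Y i

AgreeOnNbhd : ∀ {n} → Graph n → Fin n → State n → State n → Set
AgreeOnNbhd G i X Y = lookup X i ≡ lookup Y i
  × (∀ j → adj G i j ≡ true → lookup X j ≡ lookup Y j)

record LocalFunctions {n : ℕ} (G : Graph n) : Set where
  field
    fun   : Fin n → State n → Bool
    local : ∀ i X Y → AgreeOnNbhd G i X Y → fun i X ≡ fun i Y
open LocalFunctions public

Monotone : ∀ {n} {G : Graph n} → LocalFunctions G → Set
Monotone {n} f = ∀ i (X Y : State n) → X ≤ₛ Y → fun f i X ≤ᵇ fun f i Y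

inflate : ∀ {n} {G : Graph n} → LocalFunctions G → Fin n → State n → State n
inflate f i X = X [ i ]≔ fun f i X

-- Update schedule: a permutation π (position p ↦ vertex π_p)
Schedule : ℕ → Set
Schedule n = Permutation′ n

sdsMap : ∀ {n} {G : Graph n} → LocalFunctions G → Schedule n → State n → State n
sdsMap {n} f π X = foldl (λ Y p → inflate f (π ⟨$⟩ʳ p) Y) X (allFinL n)

iterate : ∀ {A : Set} → (A → A) → ℕ → A → A
iterate F zero    x = x
iterate F (suc m) x = F (iterate F m x)

GardenOfEden : ∀ {n} {G : Graph n} → LocalFunctions G → Schedule n → State n → Set
GardenOfEden f π X = ¬ (∃ λ Y → sdsMap f π Y ≡ X)

FixedPoint : ∀ {n} {G : Graph n} → LocalFunctions G → Schedule n → State n → Set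
FixedPoint f π X = sdsMap f π X ≡ X

ReachesFixedPoint : ∀ {n} {G : Graph n} → LocalFunctions G → Schedule n → State n → Set
ReachesFixedPoint f π X = ∃ λ m → FixedPoint f π (iterate (sdsMap f π) m X)

data _∼α⟨_⟩_ {n : ℕ} (π : Schedule n) (G : Graph n) (π′ : Schedule n) : Set where
  swapStep : (k k′ : Fin n) → toℕ k′ ≡ suc (toℕ k)
           → adj G (π ⟨$⟩ʳ k) (π ⟨$⟩ʳ k′) ≡ false
           → (∀ p → π′ ⟨$⟩ʳ p ≡ π ⟨$⟩ʳ (transpose k k′ ⟨$⟩ʳ p))
           → π ∼α⟨ G ⟩ π′

data _≈α⟨_⟩_ {n : ℕ} : Schedule n → Graph n → Schedule n → Set where
  ≈refl : ∀ {π G} → π ≈α⟨ G ⟩ π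
  ≈step : ∀ {π ρ σ G} → π ≈α⟨ G ⟩ ρ → ρ ∼α⟨ G ⟩ σ → π ≈α⟨ G ⟩ σ

act : ∀ {n} → Schedule n → State n → State n
act σ X = tabulate (λ i → lookup X (σ ⟨$⟩ˡ i))

InClass : ∀ {n} → Graph n → Schedule n → State n → State n → Set
InClass G π Y X = ∃ λ σ → (π ≈α⟨ G ⟩ σ) × (act σ Y ≡ X)

-- S_{0,k}: x_i = 0 for i ≤ k (1-based), 1 otherwise;  S_{1,k} the complement
S0 : (n k : ℕ) → State n
S0 n k = tabulate (λ i → not ⌊ toℕ i <? k ⌋)

S1 : (n k : ℕ) → State n
S1 n k = tabulate (λ i → ⌊ toℕ i <? k ⌋)

-- Write X = σ · S for σ ∈ [π]_α and S = S_{0,k} (set d = 1) or S = S_{1,k} (set d = 0).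
-- Swapping two non-adjacent vertices never changes the relative order of the ends of an
-- edge, so along every edge joining a vertex in state ¬d to a vertex in state d, the
-- ¬d-end is updated first under π. If X = F_π(Y), induction along π shows that every
-- vertex in state d keeps it under F_π: when such a vertex u is updated, its ¬d-neighbours
-- already carry their values from F_π(Y) = X, while its d-neighbours carry d either
-- way; so u sees at least as much d as it did when it produced x_u = d from Y, and by
-- monotonicity it produces d again. Hence X ⊑ F_π(X) in the order towards d, the orbit of
-- X climbs monotonically, and the number of coordinates equal to d must stop growing
-- after at most n steps. Having a preimage is decidable, which gives the dichotomy.

module Submission where

open import Defs
open import Data.Nat using (ℕ; zero; suc; _≤_; _<_; z≤n; s≤s; _<?_; _+_)
open import Data.Nat.Properties
  using (≤-refl; ≤-trans; <-trans; <⇒≤; ≤∧≢⇒<; <-irrefl; ≤-reflexive; ≮⇒≥; <-≤-trans; ≤-pred;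
         +-suc; +-monoʳ-≤; m≤m+n; m≤n⇒m≤1+n)
open import Data.Bool using (Bool; true; false; b≤b; f≤t; if_then_else_; _∨_; _xor_)
  renaming (_≤_ to _≤ᵇ_; _≟_ to _≟ᵇ_)
open import Data.Bool.Properties using (xor-identityʳ; xor-comm; true-xor; not-¬; ¬-not)
open import Data.Fin using (Fin; toℕ; fromℕ<; _≟_)
open import Data.Fin.Properties using (toℕ<n; toℕ-fromℕ<; toℕ-injective)
open import Data.Fin.Permutation using (_⟨$⟩ʳ_; _⟨$⟩ˡ_; inverseʳ; inverseˡ)
import Data.Fin.Permutation.Components as PC
open import Data.Fin.Subset.Properties using (anySubset?)
open import Data.Vec using ([]; _∷_; lookup; tabulate; count)
open import Data.Vec.Properties using (lookup∘update; lookup∘update′; lookup∘tabulate; ≡-dec; count≤n)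
open import Data.List using ([]; _∷_; foldl; take) renaming (allFin to allFinL)
open import Data.List.Properties using (take-suc-tabulate; foldl-∷ʳ; take-all; length-tabulate)
open import Data.Product using (∃; _×_; _,_)
open import Data.Sum using (_⊎_; inj₁; inj₂)
open import Data.Empty using (⊥-elim)
open import Function using (_∘_)
open import Relation.Nullary using (¬_; Dec; yes; no)
open import Relation.Nullary.Decidable using (⌊_⌋)
open import Relation.Binary.PropositionalEquality
  using (_≡_; _≢_; refl; sym; trans; cong; cong₂; subst; subst₂; module ≡-Reasoning)

position : ∀ {n} → Schedule n → Fin n → ℕ
position π u = toℕ (π ⟨$⟩ˡ u)

position<n : ∀ {n} (π : Schedule n) u → position π u < n
position<n π u = toℕ<n (π ⟨$⟩ˡ u)

update-step : ∀ {n} {G : Graph n} → LocalFunctions G → Schedule n → State n → Fin n → State n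
update-step f π Y p = inflate f (π ⟨$⟩ʳ p) Y

iterate-shift : ∀ {A : Set} (F : A → A) m x → iterate F m (F x) ≡ iterate F (suc m) x
iterate-shift F zero    x = refl
iterate-shift F (suc m) x = cong F (iterate-shift F m x)

module _ {n : ℕ} where

  transpose-left : (i j : Fin n) → PC.transpose i j i ≡ j
  transpose-left i j with i ≟ i
  ... | yes _   = refl
  ... | no i≢i = ⊥-elim (i≢i refl)

  transpose-right : (i j : Fin n) → PC.transpose i j j ≡ i
  transpose-right i j with j ≟ i
  ... | yes refl = refl
  ... | no _ with j ≟ j
  ...   | yes _   = refl
  ...   | no j≢j = ⊥-elim (j≢j refl)

  transpose-fixes : ∀ {i j x : Fin n} → x ≢ i → x ≢ j → PC.transpose i j x ≡ x
  transpose-fixes {i} {j} {x} x≢i x≢j with x ≟ i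
  ... | yes x≡i = ⊥-elim (x≢i x≡i)
  ... | no _ with x ≟ j
  ...   | yes x≡j = ⊥-elim (x≢j x≡j)
  ...   | no _    = refl

  private
    order-via : ∀ {a b a′ b′ : Fin n} → a ≡ a′ → b ≡ b′ → toℕ a′ < toℕ b′ → toℕ a < toℕ b
    order-via refl refl a′<b′ = a′<b′

    fixed-before-swapped : ∀ {i j a b : Fin n} → toℕ j ≡ suc (toℕ i) → toℕ a < toℕ b → a ≢ i → a ≢ j
                         → Dec (b ≡ i) → Dec (b ≡ j) → toℕ (PC.transpose i j a) < toℕ (PC.transpose i j b)
    fixed-before-swapped {i} {j} j≡1+i a<b a≢i a≢j (yes refl) _ =
      order-via (transpose-fixes a≢i a≢j) (transpose-left i j) (<-trans a<b (≤-reflexive (sym j≡1+i)))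
    fixed-before-swapped {i} {j} {a} j≡1+i a<b a≢i a≢j (no _) (yes refl) =
      order-via (transpose-fixes a≢i a≢j) (transpose-right i j)
        (≤∧≢⇒< (≤-pred (subst (toℕ a <_) j≡1+i a<b)) (λ a≡i → a≢i (toℕ-injective a≡i)))
    fixed-before-swapped j≡1+i a<b a≢i a≢j (no b≢i) (no b≢j) =
      order-via (transpose-fixes a≢i a≢j) (transpose-fixes b≢i b≢j) a<b

    adjacent-swap-< : ∀ {i j a b : Fin n} → toℕ j ≡ suc (toℕ i) → toℕ a < toℕ b → ¬ (a ≡ i × b ≡ j)
                    → Dec (a ≡ i) → Dec (a ≡ j) → toℕ (PC.transpose i j a) < toℕ (PC.transpose i j b)
    adjacent-swap-< {i} {j} {a} {b} j≡1+i a<b ¬ij (yes refl) _ =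
      order-via (transpose-left i j) (transpose-fixes b≢i b≢j)
        (≤∧≢⇒< (subst (_≤ toℕ b) (sym j≡1+i) a<b) (λ j≡b → b≢j (toℕ-injective (sym j≡b))))
      where
      b≢i : b ≢ i
      b≢i refl = <-irrefl refl a<b
      b≢j : b ≢ j
      b≢j b≡j = ¬ij (refl , b≡j)
    adjacent-swap-< {i} {j} {a} {b} j≡1+i a<b ¬ij (no _) (yes refl) =
      order-via (transpose-right i j) (transpose-fixes b≢i b≢j) (<-trans i<j a<b)
      where
      i<j : toℕ i < toℕ j
      i<j = ≤-reflexive (sym j≡1+i)
      b≢i : b ≢ i
      b≢i refl = <-irrefl refl (<-trans i<j a<b)
      b≢j : b ≢ j
      b≢j refl = <-irrefl refl a<b
    adjacent-swap-< {i} {j} {a} {b} j≡1+i a<b ¬ij (no a≢i) (no a≢j) =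
      fixed-before-swapped j≡1+i a<b a≢i a≢j (b ≟ i) (b ≟ j)

  transpose-adjacent-< : ∀ {i j a b : Fin n} → toℕ j ≡ suc (toℕ i) → toℕ a < toℕ b
                       → ¬ (a ≡ i × b ≡ j) → toℕ (PC.transpose i j a) < toℕ (PC.transpose i j b)
  transpose-adjacent-< {i} {j} {a} j≡1+i a<b ¬ij = adjacent-swap-< j≡1+i a<b ¬ij (a ≟ i) (a ≟ j)

∼α-reflects-order : ∀ {n} {G : Graph n} {ρ σ : Schedule n} {u w : Fin n} → ρ ∼α⟨ G ⟩ σ
                  → adj G u w ≡ true → position σ w < position σ u → position ρ w < position ρ u
∼α-reflects-order {G = G} {ρ} {σ} {u} {w} (swapStep k k′ k′≡1+k ρk≁ρk′ σ≡ρ∘t) uw w<u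
  = subst₂ (λ p q → toℕ p < toℕ q) (sym (position-ρ w)) (sym (position-ρ u))
      (transpose-adjacent-< k′≡1+k w<u edge-not-swapped)
  where
  open ≡-Reasoning
  t = PC.transpose k k′

  vertex-at : ∀ {v p} → σ ⟨$⟩ˡ v ≡ p → v ≡ ρ ⟨$⟩ʳ t p
  vertex-at {v} {p} σ⁻¹v≡p = begin
    v                   ≡⟨ sym (inverseʳ σ) ⟩
    σ ⟨$⟩ʳ (σ ⟨$⟩ˡ v)   ≡⟨ cong (σ ⟨$⟩ʳ_) σ⁻¹v≡p ⟩
    σ ⟨$⟩ʳ p            ≡⟨ σ≡ρ∘t p ⟩
    ρ ⟨$⟩ʳ t p          ∎

  position-ρ : ∀ v → ρ ⟨$⟩ˡ v ≡ t (σ ⟨$⟩ˡ v)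
  position-ρ v = trans (cong (ρ ⟨$⟩ˡ_) (vertex-at refl)) (inverseˡ ρ)

  edge-not-swapped : ¬ (σ ⟨$⟩ˡ w ≡ k × σ ⟨$⟩ˡ u ≡ k′)
  edge-not-swapped (σ⁻¹w≡k , σ⁻¹u≡k′) with trans (sym uw) (trans (cong₂ (adj G) u≡ρk w≡ρk′) ρk≁ρk′)
    where
    u≡ρk : u ≡ ρ ⟨$⟩ʳ k
    u≡ρk = trans (vertex-at σ⁻¹u≡k′) (cong (ρ ⟨$⟩ʳ_) (transpose-right k k′))
    w≡ρk′ : w ≡ ρ ⟨$⟩ʳ k′
    w≡ρk′ = trans (vertex-at σ⁻¹w≡k) (cong (ρ ⟨$⟩ʳ_) (transpose-left k k′))
  ... | ()

≈α-reflects-order : ∀ {n} {G : Graph n} {π σ : Schedule n} {u w : Fin n} → π ≈α⟨ G ⟩ σ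
                  → adj G u w ≡ true → position σ w < position σ u → position π w < position π u
≈α-reflects-order ≈refl                 uw w<u = w<u
≈α-reflects-order (≈step π≈ρ ρ∼σ) uw w<u = ≈α-reflects-order π≈ρ uw (∼α-reflects-order ρ∼σ uw w<u)

-- x ⊑⟨ d ⟩ y: y is at least as close to d as x. Since ⊑⟨ false ⟩ is the reversed order,
-- S_{0,k} and S_{1,k} are handled by the same argument.

_⊑⟨_⟩_ : Bool → Bool → Bool → Set
x ⊑⟨ true  ⟩ y = x ≤ᵇ y
x ⊑⟨ false ⟩ y = y ≤ᵇ x

_⊑ₛ⟨_⟩_ : ∀ {n} → State n → Bool → State n → Set
S ⊑ₛ⟨ d ⟩ T = ∀ i → lookup S i ⊑⟨ d ⟩ lookup T i

⊑-refl : ∀ {d x} → x ⊑⟨ d ⟩ x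
⊑-refl {true}  = b≤b
⊑-refl {false} = b≤b

⊑-top : ∀ {d x y} → y ≡ d → x ⊑⟨ d ⟩ y
⊑-top {true}  {false} refl = f≤t
⊑-top {true}  {true}  refl = b≤b
⊑-top {false} {false} refl = b≤b
⊑-top {false} {true}  refl = f≤t

⊑-bot : ∀ {d x y} → x ≢ d → x ⊑⟨ d ⟩ y
⊑-bot {true}  {true}          x≢d = ⊥-elim (x≢d refl)
⊑-bot {true}  {false} {false} _   = b≤b
⊑-bot {true}  {false} {true}  _   = f≤t
⊑-bot {false} {false}         x≢d = ⊥-elim (x≢d refl)
⊑-bot {false} {true}  {false} _   = f≤t
⊑-bot {false} {true}  {true}  _   = b≤b

⊑-top-unique : ∀ {d y} → d ⊑⟨ d ⟩ y → y ≡ d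
⊑-top-unique {true}  b≤b = refl
⊑-top-unique {false} b≤b = refl

module _ {n : ℕ} {G : Graph n} {f : LocalFunctions G} (mono : Monotone f) where

  monotone-⊑ : ∀ {d} i {S T : State n} → S ⊑ₛ⟨ d ⟩ T → fun f i S ⊑⟨ d ⟩ fun f i T
  monotone-⊑ {true}  i = mono i _ _
  monotone-⊑ {false} i = mono i _ _

  monotone-on-nbhd : ∀ {d} u {S T : State n}
                   → (∀ v → adj G u v ≡ true ⊎ v ≡ u → lookup S v ⊑⟨ d ⟩ lookup T v)
                   → fun f u S ⊑⟨ d ⟩ fun f u T
  monotone-on-nbhd {d} u {S} {T} S⊑T =
    subst (_⊑⟨ d ⟩ fun f u T) (sym (local f u S S′ agree)) (monotone-⊑ u S′⊑T)
    where
    choose : Fin n → Bool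
    choose v = if adj G u v ∨ ⌊ v ≟ u ⌋ then lookup S v else lookup T v
    S′ : State n
    S′ = tabulate choose

    agree : AgreeOnNbhd G u S S′
    agree = at-u , at-neighbour
      where
      at-u : lookup S u ≡ lookup S′ u
      at-u rewrite lookup∘tabulate choose u | irrefl G u with u ≟ u
      ... | yes _   = refl
      ... | no u≢u = ⊥-elim (u≢u refl)
      at-neighbour : ∀ v → adj G u v ≡ true → lookup S v ≡ lookup S′ v
      at-neighbour v uv rewrite lookup∘tabulate choose v | uv = refl

    S′⊑T : S′ ⊑ₛ⟨ d ⟩ T
    S′⊑T v rewrite lookup∘tabulate choose v with adj G u v in uv | v ≟ u
    ... | true  | _       = S⊑T v (inj₁ uv)
    ... | false | yes v≡u = S⊑T v (inj₂ v≡u)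
    ... | false | no _    = ⊑-refl

  inflate-mono : ∀ {d} i {S T : State n} → S ⊑ₛ⟨ d ⟩ T → inflate f i S ⊑ₛ⟨ d ⟩ inflate f i T
  inflate-mono i {S} {T} S⊑T j with j ≟ i
  ... | yes refl rewrite lookup∘update j S (fun f j S) | lookup∘update j T (fun f j T) = monotone-⊑ j S⊑T
  ... | no j≢i rewrite lookup∘update′ j≢i S (fun f i S) | lookup∘update′ j≢i T (fun f i T) = S⊑T j

  sdsMap-mono : ∀ {d} (π : Schedule n) {S T : State n} → S ⊑ₛ⟨ d ⟩ T → sdsMap f π S ⊑ₛ⟨ d ⟩ sdsMap f π T
  sdsMap-mono {d} π = foldl-mono (allFinL n)
    where
    foldl-mono : ∀ ps {S T} → S ⊑ₛ⟨ d ⟩ T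
               → foldl (update-step f π) S ps ⊑ₛ⟨ d ⟩ foldl (update-step f π) T ps
    foldl-mono []       S⊑T = S⊑T
    foldl-mono (p ∷ ps) {S} {T} S⊑T = foldl-mono ps (inflate-mono (π ⟨$⟩ʳ p) {S} {T} S⊑T)

module Stages {n : ℕ} {G : Graph n} (f : LocalFunctions G) (π : Schedule n) where

  stage : ℕ → State n → State n
  stage q S = foldl (update-step f π) S (take q (allFinL n))

  stage-all : ∀ S → stage n S ≡ sdsMap f π S
  stage-all S = cong (foldl (update-step f π) S)
                     (take-all n (allFinL n) (≤-reflexive (length-tabulate {n = n} (λ x → x))))

  stage-suc : ∀ {q} (q<n : q < n) S → stage (suc q) S ≡ inflate f (π ⟨$⟩ʳ fromℕ< q<n) (stage q S)
  stage-suc q<n S =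
    subst (λ m → stage (suc m) S ≡ inflate f (π ⟨$⟩ʳ i) (stage m S)) (toℕ-fromℕ< q<n)
      (trans (cong (foldl (update-step f π) S) (take-suc-tabulate (λ x → x) i))
             (foldl-∷ʳ (update-step f π) S i (take (toℕ i) (allFinL n))))
    where
    i = fromℕ< q<n

  position-scheduled : ∀ {q} (q<n : q < n) {u} → u ≡ π ⟨$⟩ʳ fromℕ< q<n → position π u ≡ q
  position-scheduled q<n refl = trans (cong toℕ (inverseˡ π)) (toℕ-fromℕ< q<n)

  scheduled-at-position : ∀ {q} (q<n : q < n) {u} → position π u ≡ q → u ≡ π ⟨$⟩ʳ fromℕ< q<n
  scheduled-at-position q<n u≡q =
    trans (sym (inverseʳ π)) (cong (π ⟨$⟩ʳ_) (toℕ-injective (trans u≡q (sym (toℕ-fromℕ< q<n)))))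

  lookup-stage-pending : ∀ q S u → q ≤ position π u → lookup (stage q S) u ≡ lookup S u
  lookup-stage-pending zero    S u _     = refl
  lookup-stage-pending (suc q) S u q<u = begin
    lookup (stage (suc q) S) u          ≡⟨ cong (λ Z → lookup Z u) (stage-suc q<n S) ⟩
    lookup (inflate f v (stage q S)) u  ≡⟨ lookup∘update′ u≢v (stage q S) _ ⟩
    lookup (stage q S) u                ≡⟨ lookup-stage-pending q S u (<⇒≤ q<u) ⟩
    lookup S u                          ∎
    where
    open ≡-Reasoning
    q<n = <-≤-trans q<u (<⇒≤ (position<n π u))
    v = π ⟨$⟩ʳ fromℕ< q<n
    u≢v : u ≢ v
    u≢v u≡v = <-irrefl (sym (position-scheduled q<n u≡v)) q<u

  lookup-stage-updated : ∀ q S u → q ≤ n → position π u < q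
                       → lookup (stage q S) u ≡ fun f u (stage (position π u) S)
  lookup-stage-updated (suc q) S u q<n u<1+q =
    trans (cong (λ Z → lookup Z u) (stage-suc q<n S)) (lookup-inflate (u ≟ π ⟨$⟩ʳ fromℕ< q<n))
    where
    lookup-inflate : Dec (u ≡ π ⟨$⟩ʳ fromℕ< q<n)
                   → lookup (inflate f (π ⟨$⟩ʳ fromℕ< q<n) (stage q S)) u ≡ fun f u (stage (position π u) S)
    lookup-inflate (yes u≡v) rewrite position-scheduled q<n u≡v | u≡v = lookup∘update _ (stage q S) _
    lookup-inflate (no u≢v) = trans (lookup∘update′ u≢v (stage q S) _)
      (lookup-stage-updated q S u (<⇒≤ q<n)
        (≤∧≢⇒< (≤-pred u<1+q) (λ u≡q → u≢v (scheduled-at-position q<n u≡q))))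

  lookup-sdsMap : ∀ S u → lookup (sdsMap f π S) u ≡ fun f u (stage (position π u) S)
  lookup-sdsMap S u =
    trans (cong (λ Z → lookup Z u) (sym (stage-all S))) (lookup-stage-updated n S u ≤-refl (position<n π u))

  lookup-stage-settled : ∀ S {u v} → position π v < position π u
                       → lookup (stage (position π u) S) v ≡ lookup (sdsMap f π S) v
  lookup-stage-settled S {u} {v} v<u =
    trans (lookup-stage-updated (position π u) S v (<⇒≤ (position<n π u)) v<u) (sym (lookup-sdsMap S v))

OppositeFirst : ∀ {n} → Graph n → Schedule n → Bool → State n → Set
OppositeFirst G π d X = ∀ u w → adj G u w ≡ true → lookup X w ≢ d → lookup X u ≡ d
                      → position π w < position π u

module _ {n : ℕ} {G : Graph n} {f : LocalFunctions G} {π : Schedule n} (mono : Monotone f)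
         {d : Bool} {X Y : State n} (preimage : sdsMap f π Y ≡ X) (opposite-first : OppositeFirst G π d X)
         where
  open Stages f π

  sdsMap-keeps-d : ∀ m u → position π u < m → lookup X u ≡ d → lookup (sdsMap f π X) u ≡ d
  sdsMap-keeps-d (suc m) u u<1+m Xu≡d =
    trans (lookup-sdsMap X u) (⊑-top-unique (subst (_⊑⟨ d ⟩ fun f u (stage p X)) Y-gives-d
                                                  (monotone-on-nbhd {f = f} mono u nbhd-⊑)))
    where
    p = position π u

    Y-gives-d : fun f u (stage p Y) ≡ d
    Y-gives-d = trans (sym (lookup-sdsMap Y u)) (trans (cong (λ Z → lookup Z u) preimage) Xu≡d)

    nbhd-⊑ : ∀ v → adj G u v ≡ true ⊎ v ≡ u → lookup (stage p Y) v ⊑⟨ d ⟩ lookup (stage p X) v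
    nbhd-⊑ .u (inj₂ refl) = ⊑-top (trans (lookup-stage-pending p X u ≤-refl) Xu≡d)
    nbhd-⊑ v  (inj₁ uv) with lookup X v ≟ᵇ d
    ... | no Xv≢d = ⊑-bot (λ Yv≡d → Xv≢d (trans (sym Yv≡Xv) Yv≡d))
      where
      Yv≡Xv : lookup (stage p Y) v ≡ lookup X v
      Yv≡Xv = trans (lookup-stage-settled Y (opposite-first u v uv Xv≢d Xu≡d))
                    (cong (λ Z → lookup Z v) preimage)
    ... | yes Xv≡d with position π v <? p
    ...   | yes v<u = ⊑-top (trans (lookup-stage-settled X v<u)
                                   (sdsMap-keeps-d m v (<-≤-trans v<u (≤-pred u<1+m)) Xv≡d))
    ...   | no v≮u  = ⊑-top (trans (lookup-stage-pending p X v (≮⇒≥ v≮u)) Xv≡d)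

  ⊑ₛ-sdsMap : X ⊑ₛ⟨ d ⟩ sdsMap f π X
  ⊑ₛ-sdsMap u with lookup X u ≟ᵇ d
  ... | yes Xu≡d = ⊑-top (sdsMap-keeps-d n u (position<n π u) Xu≡d)
  ... | no Xu≢d  = ⊑-bot Xu≢d

⊑ₛ-tail : ∀ {n d x y} {S T : State n} → (x ∷ S) ⊑ₛ⟨ d ⟩ (y ∷ T) → S ⊑ₛ⟨ d ⟩ T
⊑ₛ-tail xS⊑yT i = xS⊑yT (Data.Fin.suc i)

count-mono : ∀ {n d} (S T : State n) → S ⊑ₛ⟨ d ⟩ T → count (_≟ᵇ d) S ≤ count (_≟ᵇ d) T
count-mono         []      []      _   = z≤n
count-mono {d = d} (x ∷ S) (y ∷ T) S⊑T with x ≟ᵇ d | y ≟ᵇ d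
... | yes _    | yes _  = s≤s (count-mono S T (⊑ₛ-tail S⊑T))
... | yes refl | no y≢d = ⊥-elim (y≢d (⊑-top-unique (S⊑T Data.Fin.zero)))
... | no _     | yes _  = m≤n⇒m≤1+n (count-mono S T (⊑ₛ-tail S⊑T))
... | no _     | no _   = count-mono S T (⊑ₛ-tail S⊑T)

count-strict : ∀ {n d} (S T : State n) → S ⊑ₛ⟨ d ⟩ T → S ≢ T → count (_≟ᵇ d) S < count (_≟ᵇ d) T
count-strict         []      []      _   S≢T = ⊥-elim (S≢T refl)
count-strict {d = d} (x ∷ S) (y ∷ T) S⊑T S≢T with x ≟ᵇ d | y ≟ᵇ d
... | yes refl | no y≢d = ⊥-elim (y≢d (⊑-top-unique (S⊑T Data.Fin.zero)))
... | no _     | yes _  = s≤s (count-mono S T (⊑ₛ-tail S⊑T))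
... | yes x≡d  | yes y≡d = s≤s (count-strict S T (⊑ₛ-tail S⊑T) (S≢T ∘ cong₂ _∷_ (trans x≡d (sym y≡d))))
... | no x≢d   | no y≢d  = count-strict S T (⊑ₛ-tail S⊑T) (S≢T ∘ cong₂ _∷_ (trans (¬-not x≢d) (sym (¬-not y≢d))))

module _ {n : ℕ} {G : Graph n} {f : LocalFunctions G} {π : Schedule n} (mono : Monotone f) {d : Bool} where

  ⊑ₛ-sdsMap-reaches-fixed-point : ∀ {X} → X ⊑ₛ⟨ d ⟩ sdsMap f π X → ReachesFixedPoint f π X
  ⊑ₛ-sdsMap-reaches-fixed-point {X} = within n X (m≤m+n n _)
    where
    -- b is fuel: each step that is not yet fixed raises the d-count, which is at most n.
    within : ∀ b X → n ≤ b + count (_≟ᵇ d) X → X ⊑ₛ⟨ d ⟩ sdsMap f π X → ReachesFixedPoint f π X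
    within b X bound X⊑FX with ≡-dec _≟ᵇ_ (sdsMap f π X) X
    ... | yes FX≡X = 0 , FX≡X
    within zero X bound X⊑FX | no FX≢X =
      ⊥-elim (<-irrefl refl (<-≤-trans (count-strict _ _ X⊑FX (FX≢X ∘ sym))
                                       (≤-trans (count≤n (_≟ᵇ d) (sdsMap f π X)) bound)))
    within (suc b) X bound X⊑FX | no FX≢X
      with within b (sdsMap f π X) bound′ (sdsMap-mono {f = f} mono π X⊑FX)
      where
      bound′ : n ≤ b + count (_≟ᵇ d) (sdsMap f π X)
      bound′ = ≤-trans bound (≤-trans (≤-reflexive (sym (+-suc b _)))
                                      (+-monoʳ-≤ b (count-strict _ _ X⊑FX (FX≢X ∘ sym))))
    ... | m , fixed = suc m , subst (FixedPoint f π) (iterate-shift (sdsMap f π) m X) fixed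

lookup-act : ∀ {n} (σ : Schedule n) (S : State n) u → lookup (act σ S) u ≡ lookup S (σ ⟨$⟩ˡ u)
lookup-act σ S u = lookup∘tabulate (λ i → lookup S (σ ⟨$⟩ˡ i)) u

threshold-oppositeFirst : ∀ {n} {G : Graph n} {π σ : Schedule n} {d k} {X : State n} → π ≈α⟨ G ⟩ σ
                        → (∀ u → lookup X u ≡ d xor ⌊ position σ u <? k ⌋) → OppositeFirst G π d X
threshold-oppositeFirst {σ = σ} {d} {k} {X} π≈σ X≡threshold u w uw Xw≢d Xu≡d =
  ≈α-reflects-order π≈σ uw (<-≤-trans (below w Xw≢d) (above u Xu≡d))
  where
  below : ∀ v → lookup X v ≢ d → position σ v < k
  below v Xv≢d with position σ v <? k | X≡threshold v
  ... | yes v<k | _    = v<k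
  ... | no _    | Xv≡d = ⊥-elim (Xv≢d (trans Xv≡d (xor-identityʳ d)))
  above : ∀ v → lookup X v ≡ d → k ≤ position σ v
  above v Xv≡d with position σ v <? k | X≡threshold v
  ... | yes _   | Xv≡¬d = ⊥-elim (not-¬ Xv≡d (trans Xv≡¬d (trans (xor-comm d true) (true-xor d))))
  ... | no v≮k  | _     = ≮⇒≥ v≮k

inClass-oppositeFirst : ∀ {n} {G : Graph n} {π : Schedule n} {k} {X : State n}
                      → InClass G π (S0 n k) X ⊎ InClass G π (S1 n k) X → ∃ λ d → OppositeFirst G π d X
inClass-oppositeFirst {n} {k = k} (inj₁ (σ , π≈σ , refl)) =
  true , threshold-oppositeFirst {X = act σ (S0 n k)} π≈σ
           (λ u → trans (lookup-act σ (S0 n k) u) (lookup∘tabulate _ (σ ⟨$⟩ˡ u)))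
inClass-oppositeFirst {n} {k = k} (inj₂ (σ , π≈σ , refl)) =
  false , threshold-oppositeFirst {X = act σ (S1 n k)} π≈σ
            (λ u → trans (lookup-act σ (S1 n k) u) (lookup∘tabulate _ (σ ⟨$⟩ˡ u)))

theorem3p8 : (n : ℕ) (G : Graph n) (f : LocalFunctions G) (π : Schedule n)
    → Monotone f
    → (k : ℕ) → 1 ≤ k → k ≤ n
    → (X : State n)
    → InClass G π (S0 n k) X ⊎ InClass G π (S1 n k) X
    → GardenOfEden f π X ⊎ ReachesFixedPoint f π X
theorem3p8 n G f π mono k _ _ X inClass with anySubset? (λ Y → ≡-dec _≟ᵇ_ (sdsMap f π Y) X)
... | no no-preimage = inj₁ no-preimage
... | yes (Y , FY≡X) with inClass-oppositeFirst inClass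
...   | d , opposite-first =
  inj₂ (⊑ₛ-sdsMap-reaches-fixed-point {f = f} {π = π} mono
          (⊑ₛ-sdsMap {f = f} {π = π} mono FY≡X opposite-first))
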